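{- Let $G$ be a graph. Then $\mathrm{MObs}(G;\gamma_P(G))\ge\underline{f}(G)$.
   Context: Graphs are finite and simple with at least one vertex. Power domination: from $S\subseteq V(G)$, first $N[S]$ is observed; then repeatedly, while an observed vertex has exactly one unobserved neighbor, that neighbor becomes observed; the final set is $\mathrm{Obs}(G;S)$. $\gamma_P(G)$ is the least $|S|$ with $\mathrm{Obs}(G;S)=V(G)$. $\mathrm{maxObs}(G;k):=\max_{|S|=k}|\mathrm{Obs}(G;S)|$ and $\mathrm{MObs}(G;k):=\mathrm{maxObs}(G;k)-\mathrm{maxObs}(G;k-1)$. A fort is a nonempty $F\subseteq V(G)$ such that no vertex of $V(G)\setminus F$ has exactly one neighbor in $F$; $\underline{f}(G)$ is the minimum size of a fort. -}

module Defs where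

open import Data.Nat using (ℕ; zero; suc; _≤_)
open import Data.Nat.Properties using (_≟_)
open import Data.Bool using (Bool; true; false; _∧_; _∨_; not; if_then_else_)
open import Data.Fin using (Fin)
open import Data.List using (List; map; allFin)
open import Data.Nat.ListAction using (sum)
open import Data.Bool.ListAction using (any)
open import Data.Product using (Σ; _×_; ∃)
open import Relation.Binary.PropositionalEquality using (_≡_; _≢_)
open import Relation.Nullary.Decidable using (⌊_⌋)

record Graph (n : ℕ) : Set where
  field
    adj    : Fin n → Fin n → Bool
    sym    : ∀ u v → adj u v ≡ adj v u
    irrefl : ∀ v → adj v v ≡ false
open Graph public

VSet : ℕ → Set
VSet n = Fin n → Bool

count : ∀ {n} → VSet n → ℕ
count {n} A = sum (map (λ i → if A i then 1 else 0) (allFin n))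

closedNbhd : ∀ {n} → Graph n → VSet n → VSet n
closedNbhd {n} G S v = S v ∨ any (λ u → S u ∧ adj G u v) (allFin n)

unobsNbrs : ∀ {n} → Graph n → VSet n → Fin n → ℕ
unobsNbrs G A u = count (λ w → adj G u w ∧ not (A w))

step : ∀ {n} → Graph n → VSet n → VSet n
step {n} G A v = A v ∨ any (λ u → A u ∧ adj G u v ∧ ⌊ unobsNbrs G A u ≟ 1 ⌋) (allFin n)

iter : ∀ {n} → ℕ → Graph n → VSet n → VSet n
iter zero    G A = A
iter (suc k) G A = step G (iter k G A)

-- Obs(G;S): start from N[S], apply the propagation rule until stable
-- (n rounds suffice: each non-final round adds at least one vertex).
Obs : ∀ {n} → Graph n → VSet n → VSet n
Obs {n} G S = iter n G (closedNbhd G S)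

IsPowerDomNumber : ∀ {n} → Graph n → ℕ → Set
IsPowerDomNumber {n} G k =
  (Σ (VSet n) λ S → count S ≡ k × count (Obs G S) ≡ n)
  × (∀ (S : VSet n) → count (Obs G S) ≡ n → k ≤ count S)

IsMaxObs : ∀ {n} → Graph n → ℕ → ℕ → Set
IsMaxObs {n} G k m =
  (Σ (VSet n) λ S → count S ≡ k × count (Obs G S) ≡ m)
  × (∀ (S : VSet n) → count S ≡ k → count (Obs G S) ≤ m)

IsFort : ∀ {n} → Graph n → VSet n → Set
IsFort {n} G F =
  (∃ λ v → F v ≡ true)
  × (∀ u → F u ≡ false → count (λ w → adj G u w ∧ F w) ≢ 1)

IsMinFortSize : ∀ {n} → Graph n → ℕ → Set
IsMinFortSize {n} G f =
  (Σ (VSet n) λ F → IsFort G F × count F ≡ f)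
  × (∀ (F : VSet n) → IsFort G F → f ≤ count F)

-- Obs(G;S) is closed under the propagation rule, so no observed vertex has exactly one
-- unobserved neighbour: the unobserved set V ∖ Obs(G;S), when nonempty, is a fort.  A set S
-- of size γ_P(G) − 1 attaining maxObs(G;γ_P(G) − 1) cannot observe everything, hence
-- f̲(G) ≤ |V| − maxObs(G;γ_P(G) − 1) = maxObs(G;γ_P(G)) − maxObs(G;γ_P(G) − 1).
module Submission where

open import Defs hiding (sym)
open import Data.Nat using (ℕ; zero; suc; _+_; _∸_; _≤_; _<_; z≤n; s≤s; z<s; _≟_)
open import Data.Nat.Properties
  using ( ≤-trans; ≤-antisym; n≤1+n; 1+n≰n; m≤m+n; n≢0⇒n>0
        ; +-suc; +-comm; +-identityʳ; +-cancelˡ-≡; +-monoˡ-≤; module ≤-Reasoning)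
open import Data.Bool using (Bool; true; false; _∧_; _∨_; not; if_then_else_)
open import Data.Bool.Properties using (∨-zeroʳ; not-injective; ¬-not; ⇔→≡) renaming (_≟_ to _≟ᵇ_)
open import Data.Fin using (zero)
open import Data.Fin.Properties using (any?)
open import Data.List using (List; []; _∷_; map; allFin; length)
open import Data.List.Properties using (map-cong; length-tabulate)
open import Data.List.Relation.Unary.Any using (here; there)
open import Data.List.Membership.Propositional using (_∈_)
open import Data.List.Membership.Propositional.Properties using (∈-allFin)
open import Data.Nat.ListAction using (sum)
open import Data.Bool.ListAction using (any; or)
open import Data.Product using (∃; _,_)
open import Function.Bundles using (mk⇔)
open import Data.Sum using (_⊎_; inj₁; inj₂)
open import Relation.Binary.PropositionalEquality using (_≡_; _≢_; refl; sym; trans; subst; cong; cong₂)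
open import Relation.Nullary using (yes; no; ¬_; contradiction)
open import Relation.Nullary.Decidable using (⌊_⌋; _×-dec_)

module _ {X : Set} where

  countWhere : (X → Bool) → List X → ℕ
  countWhere p xs = sum (map (λ x → if p x then 1 else 0) xs)

  countWhere-cong : ∀ {p q : X → Bool} → (∀ x → p x ≡ q x) →
                    ∀ xs → countWhere p xs ≡ countWhere q xs
  countWhere-cong p≗q xs = cong sum (map-cong (λ x → cong (if_then 1 else 0) (p≗q x)) xs)

  countWhere-complement : ∀ (p : X → Bool) xs →
                          countWhere p xs + countWhere (λ x → not (p x)) xs ≡ length xs
  countWhere-complement p [] = refl
  countWhere-complement p (x ∷ xs) with p x
  ... | true  = cong suc (countWhere-complement p xs)
  ... | false = trans (+-suc (countWhere p xs) _) (cong suc (countWhere-complement p xs))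

  countWhere-mono : ∀ {p q : X → Bool} → (∀ x → p x ≡ true → q x ≡ true) →
                    ∀ xs → countWhere p xs ≤ countWhere q xs
  countWhere-mono p⊆q [] = z≤n
  countWhere-mono {p} {q} p⊆q (x ∷ xs) with p x in px | q x in qx
  ... | true  | true  = s≤s (countWhere-mono p⊆q xs)
  ... | true  | false = contradiction (trans (sym qx) (p⊆q x px)) λ ()
  ... | false | true  = ≤-trans (countWhere-mono p⊆q xs) (n≤1+n _)
  ... | false | false = countWhere-mono p⊆q xs

  countWhere-strict : ∀ {p q : X → Bool} → (∀ x → p x ≡ true → q x ≡ true) →
                      ∀ {xs y} → y ∈ xs → p y ≡ false → q y ≡ true →
                      countWhere p xs < countWhere q xs
  countWhere-strict p⊆q {x ∷ xs} (here refl) py qy rewrite py | qy = s≤s (countWhere-mono p⊆q xs)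
  countWhere-strict {p} {q} p⊆q {x ∷ xs} (there y∈xs) py qy with p x in px | q x in qx
  ... | true  | true  = s≤s (countWhere-strict p⊆q y∈xs py qy)
  ... | true  | false = contradiction (trans (sym qx) (p⊆q x px)) λ ()
  ... | false | true  = ≤-trans (countWhere-strict p⊆q y∈xs py qy) (n≤1+n _)
  ... | false | false = countWhere-strict p⊆q y∈xs py qy

  countWhere≡0⇒false : ∀ (p : X → Bool) xs → countWhere p xs ≡ 0 →
                       ∀ {y} → y ∈ xs → p y ≡ false
  countWhere≡0⇒false p (x ∷ xs) c≡0 y∈ with p x in px | y∈
  ... | false | here refl = px
  ... | false | there y∈xs = countWhere≡0⇒false p xs c≡0 y∈xs

  countWhere>0⇒∃ : ∀ (p : X → Bool) xs → 0 < countWhere p xs → ∃ λ x → p x ≡ true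
  countWhere>0⇒∃ p (x ∷ xs) c>0 with p x in px
  ... | true  = x , px
  ... | false = countWhere>0⇒∃ p xs c>0

  any-intro : ∀ (p : X → Bool) {xs y} → y ∈ xs → p y ≡ true → any p xs ≡ true
  any-intro p (here refl) py rewrite py = refl
  any-intro p {x ∷ _} (there y∈xs) py with p x
  ... | true  = refl
  ... | false = any-intro p y∈xs py

  any-guarded-false : ∀ (g p : X → Bool) → (∀ x → g x ≡ false) →
                      ∀ xs → any (λ x → g x ∧ p x) xs ≡ false
  any-guarded-false g p g≡false [] = refl
  any-guarded-false g p g≡false (x ∷ xs) rewrite g≡false x = any-guarded-false g p g≡false xs

  any-cong : ∀ {p q : X → Bool} → (∀ x → p x ≡ q x) → ∀ xs → any p xs ≡ any q xs
  any-cong p≗q xs = cong or (map-cong p≗q xs)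

module _ {n : ℕ} where

  count-complement : ∀ (A : VSet n) → count A + count (λ v → not (A v)) ≡ n
  count-complement A = trans (countWhere-complement A (allFin n)) (length-tabulate (λ i → i))

  count≤n : ∀ (A : VSet n) → count A ≤ n
  count≤n A = subst (count A ≤_) (count-complement A) (m≤m+n (count A) _)

  count≡0⇒empty : ∀ (A : VSet n) → count A ≡ 0 → ∀ v → A v ≡ false
  count≡0⇒empty A |A|≡0 v = countWhere≡0⇒false A (allFin n) |A|≡0 (∈-allFin v)

  count≡n⇒full : ∀ (A : VSet n) → count A ≡ n → ∀ v → A v ≡ true
  count≡n⇒full A |A|≡n v = not-injective (count≡0⇒empty (λ w → not (A w)) |∁A|≡0 v)
    where
    |∁A|≡0 : count (λ w → not (A w)) ≡ 0
    |∁A|≡0 = +-cancelˡ-≡ (count A) _ 0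
               (trans (count-complement A) (trans (sym |A|≡n) (sym (+-identityʳ (count A)))))

  count≢n⇒∃false : ∀ (A : VSet n) → count A ≢ n → ∃ λ v → not (A v) ≡ true
  count≢n⇒∃false A |A|≢n = countWhere>0⇒∃ (λ v → not (A v)) (allFin n) (n≢0⇒n>0 |∁A|≢0)
    where
    |∁A|≢0 : count (λ v → not (A v)) ≢ 0
    |∁A|≢0 |∁A|≡0 = |A|≢n (begin-equality
      count A                                ≡⟨ +-identityʳ (count A) ⟨
      count A + 0                            ≡⟨ cong (count A +_) |∁A|≡0 ⟨
      count A + count (λ v → not (A v))      ≡⟨ count-complement A ⟩
      n                                      ∎)
      where open ≤-Reasoning

  count-strict : ∀ {A B : VSet n} → (∀ v → A v ≡ true → B v ≡ true) →
                 ∀ v → A v ≡ false → B v ≡ true → count A < count B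
  count-strict A⊆B v Av Bv = countWhere-strict A⊆B (∈-allFin v) Av Bv

module Propagation {n : ℕ} (G : Graph n) where

  Closed : VSet n → Set
  Closed A = ∀ v → step G A v ≡ true → A v ≡ true

  step-inflationary : ∀ (A : VSet n) v → A v ≡ true → step G A v ≡ true
  step-inflationary A v Av rewrite Av = refl

  step-fires : ∀ (A : VSet n) u v → A u ≡ true → adj G u v ≡ true → unobsNbrs G A u ≡ 1 →
               step G A v ≡ true
  step-fires A u v Au uv one =
    trans (cong (A v ∨_) (any-intro _ (∈-allFin u) fires)) (∨-zeroʳ (A v))
    where
    fires : (A u ∧ adj G u v ∧ ⌊ unobsNbrs G A u ≟ 1 ⌋) ≡ true
    fires rewrite Au | uv | one = refl

  step-cong : ∀ {A B : VSet n} → (∀ v → A v ≡ B v) → ∀ v → step G A v ≡ step G B v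
  step-cong {A} {B} A≗B v = cong₂ _∨_ (A≗B v) (any-cong fires-cong (allFin n))
    where
    fires-cong : ∀ u → (A u ∧ adj G u v ∧ ⌊ unobsNbrs G A u ≟ 1 ⌋)
                     ≡ (B u ∧ adj G u v ∧ ⌊ unobsNbrs G B u ≟ 1 ⌋)
    fires-cong u = cong₂ (λ a c → a ∧ adj G u v ∧ ⌊ c ≟ 1 ⌋) (A≗B u)
      (countWhere-cong (λ w → cong (λ b → adj G u w ∧ not b) (A≗B w)) (allFin n))

  closed⇒step-fixed : ∀ {A : VSet n} → Closed A → ∀ v → step G A v ≡ A v
  closed⇒step-fixed {A} closed v = ⇔→≡ {z = true} (mk⇔ (closed v) (step-inflationary A v))

  step-preserves-closed : ∀ {A : VSet n} → Closed A → Closed (step G A)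
  step-preserves-closed {A} closed v stepstepAv =
    step-inflationary A v (closed v (trans (sym (step-cong (closed⇒step-fixed closed) v)) stepstepAv))

  closed-or-grows : ∀ (A : VSet n) → Closed A ⊎ count A < count (step G A)
  closed-or-grows A with any? (λ v → (step G A v ≟ᵇ true) ×-dec (A v ≟ᵇ false))
  ... | yes (v , stepAv , Av) = inj₂ (count-strict (step-inflationary A) v Av stepAv)
  ... | no ¬new = inj₁ closed
    where
    closed : Closed A
    closed v stepAv with A v ≟ᵇ true
    ... | yes Av  = Av
    ... | no  Av≢ = contradiction (v , stepAv , ¬-not Av≢) ¬new

  iter-closed-or-large : ∀ (A : VSet n) i → Closed (iter i G A) ⊎ i ≤ count (iter i G A)
  iter-closed-or-large A zero = inj₂ z≤n
  iter-closed-or-large A (suc i) with iter-closed-or-large A i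
  ... | inj₁ closed = inj₁ (step-preserves-closed closed)
  ... | inj₂ large with closed-or-grows (iter i G A)
  ...   | inj₁ closed = inj₁ (step-preserves-closed closed)
  ...   | inj₂ grows  = inj₂ (≤-trans (s≤s large) grows)

  full⇒closed : ∀ {A : VSet n} → (∀ v → A v ≡ true) → Closed A
  full⇒closed full v _ = full v

  -- At most n rounds can each add a vertex, so propagation has stopped by round n.
  Obs-closed : ∀ (S : VSet n) → Closed (Obs G S)
  Obs-closed S with iter-closed-or-large (closedNbhd G S) n
  ... | inj₁ closed = closed
  ... | inj₂ large  = full⇒closed (count≡n⇒full (Obs G S) (≤-antisym (count≤n (Obs G S)) large))

  complement-of-closed-isFort : ∀ {A : VSet n} → Closed A → (∃ λ v → not (A v) ≡ true) →
                                IsFort G (λ v → not (A v))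
  complement-of-closed-isFort {A} closed nonempty = nonempty , noForcing
    where
    noForcing : ∀ u → not (A u) ≡ false → unobsNbrs G A u ≢ 1
    noForcing u ¬Au≡false one
      with countWhere>0⇒∃ (λ w → adj G u w ∧ not (A w)) (allFin n) (subst (0 <_) (sym one) z<s)
    ... | w , uw∧¬Aw with adj G u w in uw | A w in Aw
    ...   | true | false =
      contradiction (trans (sym Aw) (closed w (step-fires A u w (not-injective ¬Au≡false) uw one))) λ ()

  step-empty : ∀ {A : VSet n} → (∀ v → A v ≡ false) → ∀ v → step G A v ≡ false
  step-empty {A} empty v rewrite empty v =
    any-guarded-false A (λ u → adj G u v ∧ ⌊ unobsNbrs G A u ≟ 1 ⌋) empty (allFin n)

  Obs-empty : ∀ {S : VSet n} → (∀ v → S v ≡ false) → ∀ v → Obs G S v ≡ false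
  Obs-empty {S} empty = iter-empty n
    where
    iter-empty : ∀ i v → iter i G (closedNbhd G S) v ≡ false
    iter-empty zero v rewrite empty v = any-guarded-false S (λ u → adj G u v) empty (allFin n)
    iter-empty (suc i) = step-empty (iter-empty i)

open Propagation

γP≢0 : ∀ {n} (G : Graph (suc n)) → ¬ IsPowerDomNumber G 0
γP≢0 G ((S , |S|≡0 , |Obs|≡all) , _) =
  contradiction (trans (sym nothingObserved) everythingObserved) λ ()
  where
  nothingObserved : Obs G S zero ≡ false
  nothingObserved = Obs-empty G (count≡0⇒empty S |S|≡0) zero
  everythingObserved : Obs G S zero ≡ true
  everythingObserved = count≡n⇒full (Obs G S) |Obs|≡all zero

below-γP-not-dominating : ∀ {n} (G : Graph (suc n)) {k} → IsPowerDomNumber G k →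
                          ∀ S → count S ≡ k ∸ 1 → count (Obs G S) ≢ suc n
below-γP-not-dominating G {zero}  γP _ _ _ = γP≢0 G γP
below-γP-not-dominating G {suc k} (_ , minimal) S |S|≡k dominates =
  1+n≰n (subst (suc k ≤_) |S|≡k (minimal S dominates))

mainTheorem13 : ∀ (n : ℕ) (G : Graph (suc n)) (k m m′ f : ℕ)
    → IsPowerDomNumber G k
    → IsMaxObs G k m
    → IsMaxObs G (k ∸ 1) m′
    → IsMinFortSize G f
    → f + m′ ≤ m
mainTheorem13 n G k m m′ f γP@((S , |S|≡k , |ObsS|≡all) , _) (_ , maxObs-k)
              ((S′ , |S′|≡k∸1 , |ObsS′|≡m′) , _) (_ , minFort) = begin
  f + m′              ≤⟨ +-monoˡ-≤ m′ (minFort U U-isFort) ⟩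
  count U + m′        ≡⟨ cong (count U +_) |ObsS′|≡m′ ⟨
  count U + count A   ≡⟨ +-comm (count U) (count A) ⟩
  count A + count U   ≡⟨ count-complement A ⟩
  suc n               ≡⟨ |ObsS|≡all ⟨
  count (Obs G S)     ≤⟨ maxObs-k S |S|≡k ⟩
  m                   ∎
  where
  open ≤-Reasoning
  A U : VSet (suc n)
  A = Obs G S′
  U v = not (A v)
  U-isFort : IsFort G U
  U-isFort = complement-of-closed-isFort G (Obs-closed G S′)
               (count≢n⇒∃false A (below-γP-not-dominating G γP S′ |S′|≡k∸1))
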